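{- Let $V$ be a finite set with a fixed cyclic order, and let $r$ and $s$ be two circle separations of $V$. If $r$ and $s$ cross, then all four corner separations of $r$ and $s$ (taken in the universe of all bipartitions of $V$) are again circle separations.
   Context: The universe of bipartitions of $V$ consists of ordered pairs $(A,B)$ with $A\cup B=V$, $A\cap B=\emptyset$, with involution $(A,B)^*=(B,A)$, partial order $(A,B)\le(C,D)$ iff $A\subseteq C$ (equivalently $B\supseteq D$), join $(A\cup C,B\cap D)$ and meet $(A\cap C,B\cup D)$. A circle separation is a bipartition $(A,B)$ of $V$ into two intervals of the cyclic order. Two separations $r,s$ are nested if they have orientations with $\vec r\le\vec s$, and cross otherwise; the corner separations of $r,s$ are the $\vec r\vee\vec s$ over all choices of orientations. -}

module Defs where

open import Data.Nat using (ℕ; zero; suc; _<_; _≤_; NonZero)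
open import Data.Fin using (Fin; toℕ; fromℕ<)
open import Data.Nat.DivMod using (_mod_)
open import Data.Bool using (Bool; true; false; not; _∨_; _∧_)
open import Data.Product using (Σ; ∃; _×_; _,_)
open import Data.Sum using (_⊎_)
open import Relation.Nullary using (¬_)
open import Relation.Binary.PropositionalEquality using (_≡_)
open import Function.Bundles using (_⇔_)

-- The ground set V is Fin n with the cyclic order 0 → 1 → … → n-1 → 0
-- (every finite cyclically ordered set is isomorphic to this one).

-- A bipartition (A , B) of V is given by the characteristic function of A;
-- B is the complement.
Bip : ℕ → Set
Bip n = Fin n → Bool

_∈A_ : ∀ {n} → Fin n → Bip n → Set
v ∈A s = s v ≡ true

_* : ∀ {n} → Bip n → Bip n
(s *) v = not (s v)

_≤B_ : ∀ {n} → Bip n → Bip n → Set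
s ≤B t = ∀ v → s v ≡ true → t v ≡ true

_∨B_ : ∀ {n} → Bip n → Bip n → Bip n
(s ∨B t) v = s v ∨ t v

_∧B_ : ∀ {n} → Bip n → Bip n → Bip n
(s ∧B t) v = s v ∧ t v

shift : ∀ {n} → Fin n → ℕ → Fin n
shift {suc n} a i = (toℕ a Data.Nat.+ i) mod (suc n)

-- X ⊆ V (as a characteristic function) is an interval of the cyclic order:
-- X = {a, a+1, …, a+k-1} (mod n) for some start a and length k ≤ n.
-- (This includes the empty set and V itself.)
IsInterval : ∀ {n} → (Fin n → Bool) → Set
IsInterval {n} X =
  (∀ v → X v ≡ false) ⊎
  Σ (Fin n) λ a → Σ ℕ λ k → k ≤ n ×
    (∀ v → (X v ≡ true) ⇔ (Σ ℕ λ i → i < k × shift a i ≡ v))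

IsCircleSep : ∀ {n} → Bip n → Set
IsCircleSep s = IsInterval s × IsInterval (s *)

-- unoriented separations r, s (given by one orientation each) are nested
-- if some orientations satisfy r⃗ ≤ s⃗
Nested : ∀ {n} → Bip n → Bip n → Set
Nested r s = (r ≤B s) ⊎ (r ≤B (s *)) ⊎ ((r *) ≤B s) ⊎ ((r *) ≤B (s *))

Cross : ∀ {n} → Bip n → Bip n → Set
Cross r s = ¬ Nested r s

module Submission where

-- Fix a crossing pair r, s and a corner, say r ∨ s (the other three corners
-- are the same statement for r* and/or s*, which cross as well).  Crossing
-- yields a point q lying in both r and s (as r ≰ s*) and a point p lying in
-- neither (as r* ≰ s).  Cutting the circle open at p turns the cyclic
-- intervals r and s into ranges [lo₁, hi₁) and [lo₂, hi₂) of offsets from p;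
-- both contain the offset of q, so their union is the range
-- [lo₁ ⊓ lo₂, hi₁ ⊔ hi₂), hence again a cyclic interval, and so is its
-- complement.  Thus r ∨ s is a circle separation.

open import Defs
open import Data.Nat using (ℕ; zero; suc; _+_; _∸_; _<_; _≤_; _%_; _⊓_; _⊔_; z≤n; s≤s)
open import Data.Nat.Properties
open import Data.Nat.DivMod using (%-distribˡ-+; m%n%n≡m%n; [m+n]%n≡m%n; m<n⇒m%n≡m; m%n<n; n%n≡0)
open import Algebra.Properties.CommutativeSemigroup +-commutativeSemigroup using (x∙yz≈y∙xz)
open import Data.Fin using (Fin; toℕ)
open import Data.Fin.Properties using (toℕ-injective; toℕ-fromℕ<; toℕ<n; ¬∀⟶∃¬)
open import Data.Bool using (true; false; not; _∨_)
open import Data.Bool.Properties using (not-involutive; not-injective) renaming (_≟_ to _≟ᵇ_)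
open import Data.Product using (Σ; _×_; _,_; proj₁; proj₂)
open import Data.Sum using (_⊎_; inj₁; inj₂; [_,_])
open import Data.Sum.Function.Propositional using (_⊎-⇔_)
open import Function using (id; const; _∘_)
open import Function.Bundles using (_⇔_; mk⇔; Equivalence)
open import Function.Properties.Equivalence using () renaming (trans to ⇔-trans; sym to ⇔-sym)
open import Relation.Nullary using (¬_; contradiction; yes; no)
open import Relation.Nullary.Decidable using (_→-dec_)
open import Relation.Binary.PropositionalEquality hiding ([_])

open Equivalence using (to; from)

∨-≡-true : ∀ x y → (x ∨ y ≡ true) ⇔ (x ≡ true ⊎ y ≡ true)
∨-≡-true true  y = mk⇔ inj₁ (const refl)
∨-≡-true false y = mk⇔ inj₂ [ (λ ()) , id ]

not-⇔ : ∀ b {P : Set} → (b ≡ true ⇔ P) → (not b ≡ true ⇔ (¬ P))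
not-⇔ true  b⇔P = mk⇔ (λ ()) (λ ¬P → contradiction (to b⇔P refl) ¬P)
not-⇔ false b⇔P = mk⇔ (λ _ P → contradiction (from b⇔P P) λ ()) (λ _ → refl)

counterexample : ∀ {n} (X Y : Bip n) → ¬ (X ≤B Y) →
  Σ (Fin n) λ v → X v ≡ true × Y v ≡ false
counterexample {n} X Y X≰Y
  with ¬∀⟶∃¬ n (λ v → X v ≡ true → Y v ≡ true) (λ v → (X v ≟ᵇ true) →-dec (Y v ≟ᵇ true)) X≰Y
... | v , ¬X⇒Y = v , refute (X v) (Y v) ¬X⇒Y
  where
  refute : ∀ x y → ¬ (x ≡ true → y ≡ true) → x ≡ true × y ≡ false
  refute true  false _    = refl , refl
  refute true  true  ¬x⇒y = contradiction (const refl) ¬x⇒y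
  refute false _     ¬x⇒y = contradiction (λ ()) ¬x⇒y

*-involutive : ∀ {n} (s : Bip n) → (s *) * ≗ s
*-involutive s v = not-involutive (s v)

≤B-resp : ∀ {n} {X X′ Y Y′ : Bip n} → X′ ≗ X → Y ≗ Y′ → X ≤B Y → X′ ≤B Y′
≤B-resp X′≗X Y≗Y′ X≤Y v X′v = trans (sym (Y≗Y′ v)) (X≤Y v (trans (sym (X′≗X v)) X′v))

cross-flipʳ : ∀ {n} {r s : Bip n} → Cross r s → Cross r (s *)
cross-flipʳ {r = r} {s} r⨯s = r⨯s ∘ reorient
  where
  reorient : Nested r (s *) → Nested r s
  reorient (inj₁ r≤s*)                 = inj₂ (inj₁ r≤s*)
  reorient (inj₂ (inj₁ r≤s**))         = inj₁ (≤B-resp (λ _ → refl) (*-involutive s) r≤s**)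
  reorient (inj₂ (inj₂ (inj₁ r*≤s*)))  = inj₂ (inj₂ (inj₂ r*≤s*))
  reorient (inj₂ (inj₂ (inj₂ r*≤s**))) = inj₂ (inj₂ (inj₁ (≤B-resp (λ _ → refl) (*-involutive s) r*≤s**)))

cross-flipˡ : ∀ {n} {r s : Bip n} → Cross r s → Cross (r *) s
cross-flipˡ {r = r} {s} r⨯s = r⨯s ∘ reorient
  where
  reorient : Nested (r *) s → Nested r s
  reorient (inj₁ r*≤s)                 = inj₂ (inj₂ (inj₁ r*≤s))
  reorient (inj₂ (inj₁ r*≤s*))         = inj₂ (inj₂ (inj₂ r*≤s*))
  reorient (inj₂ (inj₂ (inj₁ r**≤s)))  = inj₁ (≤B-resp (sym ∘ *-involutive r) (λ _ → refl) r**≤s)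
  reorient (inj₂ (inj₂ (inj₂ r**≤s*))) = inj₂ (inj₁ (≤B-resp (sym ∘ *-involutive r) (λ _ → refl) r**≤s*))

InRange : ℕ → ℕ → ℕ → Set
InRange lo hi x = lo ≤ x × x < hi

range-union : ∀ {lo₁ hi₁ lo₂ hi₂ j} → InRange lo₁ hi₁ j → InRange lo₂ hi₂ j →
  ∀ x → InRange (lo₁ ⊓ lo₂) (hi₁ ⊔ hi₂) x ⇔ (InRange lo₁ hi₁ x ⊎ InRange lo₂ hi₂ x)
range-union {lo₁} {hi₁} {lo₂} {hi₂} (lo₁≤j , j<hi₁) (lo₂≤j , j<hi₂) x =
  mk⇔ split (λ { (inj₁ (l , h)) → ≤-trans (m⊓n≤m lo₁ lo₂) l , <-≤-trans h (m≤m⊔n hi₁ hi₂)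
               ; (inj₂ (l , h)) → ≤-trans (m⊓n≤n lo₁ lo₂) l , <-≤-trans h (m≤n⊔m hi₁ hi₂) })
  where
  split : InRange (lo₁ ⊓ lo₂) (hi₁ ⊔ hi₂) x → InRange lo₁ hi₁ x ⊎ InRange lo₂ hi₂ x
  split (lo≤x , x<hi) with lo₁ ≤? x | x <? hi₁
  ... | yes lo₁≤x | yes x<hi₁ = inj₁ (lo₁≤x , x<hi₁)
  ... | yes _     | no x≮hi₁  = inj₂ (≤-trans (<⇒≤ (≤-<-trans lo₂≤j j<hi₁)) (≮⇒≥ x≮hi₁) , x<hi₂)
    where
    x<hi₂ : x < hi₂
    x<hi₂ with x <? hi₂
    ... | yes x<hi₂ = x<hi₂
    ... | no x≮hi₂  = contradiction (⊔-lub (≮⇒≥ x≮hi₁) (≮⇒≥ x≮hi₂)) (<⇒≱ x<hi)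
  ... | no lo₁≰x  | _         = inj₂ (lo₂≤x , <-trans (≰⇒> lo₁≰x) (≤-<-trans lo₁≤j j<hi₂))
    where
    lo₂≤x : lo₂ ≤ x
    lo₂≤x with lo₂ ≤? x
    ... | yes lo₂≤x = lo₂≤x
    ... | no lo₂≰x  = contradiction (⊓-glb (≰⇒> lo₁≰x) (≰⇒> lo₂≰x)) (≤⇒≯ lo≤x)

module Cyclic (m : ℕ) where

  N : ℕ
  N = suc m

  toℕ-shift : ∀ a i → toℕ (shift a i) ≡ (toℕ a + i) % N
  toℕ-shift a i = toℕ-fromℕ< _

  %-absorbˡ : ∀ x y → (x % N + y) % N ≡ (x + y) % N
  %-absorbˡ x y = begin
    (x % N + y) % N           ≡⟨ %-distribˡ-+ (x % N) y N ⟩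
    (x % N % N + y % N) % N   ≡⟨ cong (λ t → (t + y % N) % N) (m%n%n≡m%n x N) ⟩
    (x % N + y % N) % N       ≡⟨ %-distribˡ-+ x y N ⟨
    (x + y) % N               ∎
    where open ≡-Reasoning

  shift-≡ : ∀ a i b j → (toℕ a + i) % N ≡ (toℕ b + j) % N → shift a i ≡ shift b j
  shift-≡ a i b j e = toℕ-injective (trans (toℕ-shift a i) (trans e (sym (toℕ-shift b j))))

  shift-+ : ∀ a i j → shift (shift a i) j ≡ shift a (i + j)
  shift-+ a i j = shift-≡ (shift a i) j a (i + j) (begin
    (toℕ (shift a i) + j) % N   ≡⟨ cong (λ t → (t + j) % N) (toℕ-shift a i) ⟩
    ((toℕ a + i) % N + j) % N   ≡⟨ %-absorbˡ (toℕ a + i) j ⟩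
    (toℕ a + i + j) % N         ≡⟨ cong (_% N) (+-assoc (toℕ a) i j) ⟩
    (toℕ a + (i + j)) % N       ∎)
    where open ≡-Reasoning

  shift-N : ∀ a i → shift a (N + i) ≡ shift a i
  shift-N a i = shift-≡ a (N + i) a i (begin
    (toℕ a + (N + i)) % N   ≡⟨ cong (_% N) (x∙yz≈y∙xz (toℕ a) N i) ⟩
    (N + (toℕ a + i)) % N   ≡⟨ cong (_% N) (+-comm N (toℕ a + i)) ⟩
    (toℕ a + i + N) % N     ≡⟨ [m+n]%n≡m%n (toℕ a + i) N ⟩
    (toℕ a + i) % N         ∎)
    where open ≡-Reasoning

  -- the offset of v from p: the unique i < N with shift p i ≡ v
  pos : Fin N → Fin N → ℕ
  pos p v = (toℕ v + (N ∸ toℕ p)) % N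

  pos<N : ∀ p v → pos p v < N
  pos<N p v = m%n<n (toℕ v + (N ∸ toℕ p)) N

  p+[N∸p]≡N : ∀ (p : Fin N) → toℕ p + (N ∸ toℕ p) ≡ N
  p+[N∸p]≡N p = m+[n∸m]≡n (<⇒≤ (toℕ<n p))

  shift-pos : ∀ p v → shift p (pos p v) ≡ v
  shift-pos p v = toℕ-injective (begin
    toℕ (shift p (pos p v))                   ≡⟨ toℕ-shift p (pos p v) ⟩
    (toℕ p + pos p v) % N                     ≡⟨ cong (_% N) (+-comm (toℕ p) (pos p v)) ⟩
    (pos p v + toℕ p) % N                     ≡⟨ %-absorbˡ (toℕ v + (N ∸ toℕ p)) (toℕ p) ⟩
    (toℕ v + (N ∸ toℕ p) + toℕ p) % N         ≡⟨ cong (_% N) (+-assoc (toℕ v) _ (toℕ p)) ⟩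
    (toℕ v + ((N ∸ toℕ p) + toℕ p)) % N       ≡⟨ cong (λ t → (toℕ v + t) % N) (m∸n+n≡m (<⇒≤ (toℕ<n p))) ⟩
    (toℕ v + N) % N                           ≡⟨ [m+n]%n≡m%n (toℕ v) N ⟩
    toℕ v % N                                 ≡⟨ m<n⇒m%n≡m (toℕ<n v) ⟩
    toℕ v                                     ∎)
    where open ≡-Reasoning

  pos-shift : ∀ p {i} → i < N → pos p (shift p i) ≡ i
  pos-shift p {i} i<N = begin
    (toℕ (shift p i) + (N ∸ toℕ p)) % N    ≡⟨ cong (λ t → (t + (N ∸ toℕ p)) % N) (toℕ-shift p i) ⟩
    ((toℕ p + i) % N + (N ∸ toℕ p)) % N    ≡⟨ %-absorbˡ (toℕ p + i) (N ∸ toℕ p) ⟩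
    (toℕ p + i + (N ∸ toℕ p)) % N          ≡⟨ cong (_% N) (+-assoc (toℕ p) i _) ⟩
    (toℕ p + (i + (N ∸ toℕ p))) % N        ≡⟨ cong (_% N) (x∙yz≈y∙xz (toℕ p) i _) ⟩
    (i + (toℕ p + (N ∸ toℕ p))) % N        ≡⟨ cong (λ t → (i + t) % N) (p+[N∸p]≡N p) ⟩
    (i + N) % N                            ≡⟨ [m+n]%n≡m%n i N ⟩
    i % N                                  ≡⟨ m<n⇒m%n≡m i<N ⟩
    i                                      ∎
    where open ≡-Reasoning

  pos-unique : ∀ a {v i} → i < N → shift a i ≡ v → pos a v ≡ i
  pos-unique a i<N refl = pos-shift a i<N

  pos-self : ∀ p → pos p p ≡ 0
  pos-self p = trans (cong (_% N) (p+[N∸p]≡N p)) (n%n≡0 N)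

  rebase-≥ : ∀ p v {d} → d ≤ pos p v → pos (shift p d) v ≡ pos p v ∸ d
  rebase-≥ p v {d} d≤x = pos-unique (shift p d) (≤-<-trans (m∸n≤m (pos p v) d) (pos<N p v))
    (trans (shift-+ p d _) (trans (cong (shift p) (m+[n∸m]≡n d≤x)) (shift-pos p v)))

  rebase-< : ∀ p v {d} → d ≤ N → pos p v < d → pos (shift p d) v ≡ N ∸ d + pos p v
  rebase-< p v {d} d≤N x<d = pos-unique (shift p d)
    (subst (N ∸ d + pos p v <_) (m∸n+n≡m d≤N) (+-monoʳ-< (N ∸ d) x<d))
    (begin
      shift (shift p d) (N ∸ d + pos p v)   ≡⟨ shift-+ p d _ ⟩
      shift p (d + (N ∸ d + pos p v))       ≡⟨ cong (shift p) (sym (+-assoc d (N ∸ d) _)) ⟩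
      shift p (d + (N ∸ d) + pos p v)       ≡⟨ cong (λ t → shift p (t + pos p v)) (m+[n∸m]≡n d≤N) ⟩
      shift p (N + pos p v)                 ≡⟨ shift-N p (pos p v) ⟩
      shift p (pos p v)                     ≡⟨ shift-pos p v ⟩
      v                                     ∎)
    where open ≡-Reasoning

  Window : Fin N → ℕ → Bip N → Set
  Window a k X = ∀ v → X v ≡ true ⇔ pos a v < k

  window-points : ∀ a {k} v → k ≤ N → (Σ ℕ λ i → i < k × shift a i ≡ v) ⇔ pos a v < k
  window-points a v k≤N = mk⇔
    (λ { (i , i<k , e) → subst (_< _) (sym (pos-unique a (<-≤-trans i<k k≤N) e)) i<k })
    (λ x<k → pos a v , x<k , shift-pos a v)

  interval⇒window : ∀ {X} → IsInterval X → Σ (Fin N) λ a → Σ ℕ λ k → k ≤ N × Window a k X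
  interval⇒window (inj₁ empty) =
    Data.Fin.zero , 0 , z≤n , λ v → mk⇔ (λ Xv → contradiction (trans (sym Xv) (empty v)) λ ()) λ ()
  interval⇒window (inj₂ (a , k , k≤N , X⇔)) =
    a , k , k≤N , λ v → ⇔-trans (X⇔ v) (window-points a v k≤N)

  window⇒interval : ∀ {X} a k → k ≤ N → Window a k X → IsInterval X
  window⇒interval a k k≤N w =
    inj₂ (a , k , k≤N , λ v → ⇔-trans (w v) (⇔-sym (window-points a v k≤N)))

  window-complement : ∀ {X} a k → k ≤ N → Window a k X → Window (shift a k) (N ∸ k) (X *)
  window-complement {X} a k k≤N w v = ⇔-trans (not-⇔ (X v) (w v)) (mk⇔ outside inside)
    where
    x : ℕ
    x = pos a v
    outside : ¬ (x < k) → pos (shift a k) v < N ∸ k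
    outside x≮k = subst (_< N ∸ k) (sym (rebase-≥ a v (≮⇒≥ x≮k))) (∸-monoˡ-< (pos<N a v) (≮⇒≥ x≮k))
    inside : pos (shift a k) v < N ∸ k → ¬ (x < k)
    inside y<N∸k x<k = <⇒≱ y<N∸k
      (subst (N ∸ k ≤_) (sym (rebase-< a v k≤N x<k)) (m≤m+n (N ∸ k) x))

  CutRange : Fin N → ℕ → ℕ → Bip N → Set
  CutRange p lo hi X = lo ≤ hi × hi ≤ N × (∀ v → X v ≡ true ⇔ InRange lo hi (pos p v))

  window-as-range : ∀ p {lo hi} → lo ≤ hi → hi ≤ N → ∀ v →
    pos (shift p lo) v < hi ∸ lo ⇔ InRange lo hi (pos p v)
  window-as-range p {lo} {hi} lo≤hi hi≤N v with lo ≤? pos p v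
  ... | yes lo≤x rewrite rebase-≥ p v lo≤x = mk⇔
    (λ y<k → lo≤x , subst (pos p v <_) (m∸n+n≡m lo≤hi)
               (subst (_< hi ∸ lo + lo) (m∸n+n≡m lo≤x) (+-monoˡ-< lo y<k)))
    (λ (_ , x<hi) → ∸-monoˡ-< x<hi lo≤x)
  ... | no lo≰x rewrite rebase-< p v (≤-trans lo≤hi hi≤N) (≰⇒> lo≰x) = mk⇔
    (λ y<k → contradiction (≤-trans (∸-monoˡ-≤ lo hi≤N) (m≤m+n (N ∸ lo) (pos p v))) (<⇒≱ y<k))
    (λ (lo≤x , _) → contradiction lo≤x lo≰x)

  cutRange⇒window : ∀ {X} p lo hi → CutRange p lo hi X → Window (shift p lo) (hi ∸ lo) X
  cutRange⇒window p lo hi (lo≤hi , hi≤N , X⇔) v =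
    ⇔-trans (X⇔ v) (⇔-sym (window-as-range p lo≤hi hi≤N v))

  window-fits : ∀ {X} p d k → d < N → k ≤ N → Window (shift p d) k X → X p ≡ false → d + k ≤ N
  window-fits p zero k _ k≤N _ _ = k≤N
  window-fits {X} p d@(suc _) k d<N _ w Xp≡false =
    subst (d + k ≤_) (m+[n∸m]≡n (<⇒≤ d<N)) (+-monoʳ-≤ d (subst (k ≤_) offset-p (≮⇒≥ p∉X)))
    where
    offset-p : pos (shift p d) p ≡ N ∸ d
    offset-p = begin
      pos (shift p d) p   ≡⟨ rebase-< p p (<⇒≤ d<N) (subst (_< d) (sym (pos-self p)) (s≤s z≤n)) ⟩
      N ∸ d + pos p p     ≡⟨ cong (N ∸ d +_) (pos-self p) ⟩
      N ∸ d + 0           ≡⟨ +-identityʳ (N ∸ d) ⟩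
      N ∸ d               ∎
      where open ≡-Reasoning
    p∉X : ¬ (pos (shift p d) p < k)
    p∉X p<k = contradiction (trans (sym (from (w p) p<k)) Xp≡false) λ ()

  window⇒cutRange : ∀ {X} p a k → k ≤ N → Window a k X → X p ≡ false →
    Σ ℕ λ lo → Σ ℕ λ hi → CutRange p lo hi X
  window⇒cutRange {X} p a k k≤N w Xp≡false =
    d , d + k , m≤m+n d k , d+k≤N , λ v → ⇔-trans (w′ v) (range v)
    where
    d : ℕ
    d = pos p a
    w′ : Window (shift p d) k X
    w′ = subst (λ b → Window b k X) (sym (shift-pos p a)) w
    d+k≤N : d + k ≤ N
    d+k≤N = window-fits p d k (pos<N p a) k≤N w′ Xp≡false
    range : ∀ v → pos (shift p d) v < k ⇔ InRange d (d + k) (pos p v)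
    range v = subst (λ j → pos (shift p d) v < j ⇔ InRange d (d + k) (pos p v))
                    (m+n∸m≡n d k) (window-as-range p (m≤m+n d k) d+k≤N v)

  cutRange-union : ∀ {X Y} p q lo₁ hi₁ lo₂ hi₂ →
    CutRange p lo₁ hi₁ X → CutRange p lo₂ hi₂ Y → X q ≡ true → Y q ≡ true →
    CutRange p (lo₁ ⊓ lo₂) (hi₁ ⊔ hi₂) (X ∨B Y)
  cutRange-union {X} {Y} p q lo₁ hi₁ lo₂ hi₂ (l₁ , h₁ , X⇔) (l₂ , h₂ , Y⇔) Xq Yq =
    ≤-trans (m⊓n≤m lo₁ lo₂) (≤-trans l₁ (m≤m⊔n hi₁ hi₂)) , ⊔-lub h₁ h₂ ,
    λ v → ⇔-trans (∨-≡-true (X v) (Y v))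
            (⇔-trans (X⇔ v ⊎-⇔ Y⇔ v) (⇔-sym (range-union (to (X⇔ _) Xq) (to (Y⇔ _) Yq) _)))

  union-circleSep : ∀ {X Y : Bip N} {q p} → IsInterval X → IsInterval Y →
    X q ≡ true → Y q ≡ true → X p ≡ false → Y p ≡ false → IsCircleSep (X ∨B Y)
  union-circleSep {X} {Y} {q} {p} iX iY Xq Yq Xp Yp
    with interval⇒window iX | interval⇒window iY
  ... | a₁ , k₁ , k₁≤N , w₁ | a₂ , k₂ , k₂≤N , w₂
    with window⇒cutRange p a₁ k₁ k₁≤N w₁ Xp | window⇒cutRange p a₂ k₂ k₂≤N w₂ Yp
  ... | lo₁ , hi₁ , c₁ | lo₂ , hi₂ , c₂ =
    window⇒interval a k k≤N w ,
    window⇒interval (shift a k) (N ∸ k) (m∸n≤m N k) (window-complement a k k≤N w)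
    where
    lo hi k : ℕ
    lo = lo₁ ⊓ lo₂
    hi = hi₁ ⊔ hi₂
    k = hi ∸ lo
    a : Fin N
    a = shift p lo
    c : CutRange p lo hi (X ∨B Y)
    c = cutRange-union p q lo₁ hi₁ lo₂ hi₂ c₁ c₂ Xq Yq
    w : Window a k (X ∨B Y)
    w = cutRange⇒window p lo hi c
    k≤N : k ≤ N
    k≤N = ≤-trans (m∸n≤m hi lo) (proj₁ (proj₂ c))

-- the previous lemma over an arbitrary finite cycle (the points q, p rule out Fin 0)
union-circleSep : ∀ {n} {X Y : Bip n} (q p : Fin n) → IsInterval X → IsInterval Y →
  X q ≡ true → Y q ≡ true → X p ≡ false → Y p ≡ false → IsCircleSep (X ∨B Y)
union-circleSep {suc m} _ _ = Cyclic.union-circleSep m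

crossing-corner : ∀ {n} (r s : Bip n) → IsInterval r → IsInterval s → Cross r s → IsCircleSep (r ∨B s)
crossing-corner r s ir is r⨯s
  with counterexample r (s *) (r⨯s ∘ inj₂ ∘ inj₁) | counterexample (r *) s (r⨯s ∘ inj₂ ∘ inj₂ ∘ inj₁)
... | q , rq , s*q≡false | p , r*p≡true , sp =
  union-circleSep q p ir is rq (not-injective s*q≡false) (not-injective r*p≡true) sp

lemma19 : (n : ℕ) (r s : Bip n) →
    IsCircleSep r → IsCircleSep s → Cross r s →
    IsCircleSep (r ∨B s) × IsCircleSep (r ∨B (s *)) ×
    IsCircleSep ((r *) ∨B s) × IsCircleSep ((r *) ∨B (s *))
lemma19 n r s (ir , ir*) (is , is*) r⨯s =
  crossing-corner r s ir is r⨯s ,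
  crossing-corner r (s *) ir is* (cross-flipʳ r⨯s) ,
  crossing-corner (r *) s ir* is (cross-flipˡ r⨯s) ,
  crossing-corner (r *) (s *) ir* is* (cross-flipʳ (cross-flipˡ r⨯s))
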